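{- Let $w_{\sigma}$ be the $\sigma$-sequence over the alphabet $\{1,3\}$. There does not exist a morphism $f:\{1,3\}^{\star}\to\{1,3\}^{\star}$ whose iteration defines $w_{\sigma}$, i.e. there is no morphism $f$ with $w_{\sigma}=\lim_{k\to\infty}f^k(1)$ (meaning $|f^k(1)|\to\infty$ and, for every $N$, the first $N$ letters of $f^k(1)$ coincide with the first $N$ letters of $w_\sigma$ for all sufficiently large $k$).
   Context: Every natural number $n\ge 1$ can be written uniquely as $n=2^t(4s+\sigma)$ with integers $t,s\ge 0$ and $\sigma\in\{1,3\}$ (here $2^t$ is the largest power of $2$ dividing $n$). The $\sigma$-sequence $w_\sigma$ is the infinite sequence whose $n$-th letter ($n=1,2,3,\dots$) is this value $\sigma$ for $n$; it begins $11311331113313\ldots$. A morphism $f$ on $\{1,3\}^{\star}$ (the set of finite words over $\{1,3\}$) is a map with $f(uv)=f(u)f(v)$ for all words $u,v$. -}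

module Defs where

open import Data.Nat using (ℕ; zero; suc; _+_; _%_; _/_)
open import Data.List using (List; []; _∷_; concatMap)

data Letter : Set where
  one three : Letter

Word : Set
Word = List Letter

record Morphism : Set where
  constructor morph
  field
    img1 : Word
    img3 : Word

image : Morphism → Letter → Word
image f one   = Morphism.img1 f
image f three = Morphism.img3 f

apply : Morphism → Word → Word
apply f = concatMap (image f)

iter : Morphism → ℕ → Word → Word
iter f zero    u = u
iter f (suc k) u = apply f (iter f k u)

-- Odd part of n (n divided by the largest power of 2 dividing it), for n ≥ 1,
-- computed with fuel (fuel ≥ n suffices).
oddPartAux : ℕ → ℕ → ℕ
oddPartAux zero       n = n
oddPartAux (suc fuel) n with n % 2
... | zero  = oddPartAux fuel (n / 2)
... | suc _ = n

oddPart : ℕ → ℕ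
oddPart n = oddPartAux n n

-- σ(n) for n ≥ 1: n = 2^t (4s + σ), σ ∈ {1,3}, i.e. σ ≡ oddPart n mod 4.
sigma : ℕ → Letter
sigma n with oddPart n % 4
... | 1 = one
... | _ = three

-- The σ-sequence, 0-indexed: wσ i is the (i+1)-th letter, i.e. σ(i+1).
wσ : ℕ → Letter
wσ i = sigma (suc i)

prefix : (ℕ → Letter) → ℕ → Word
prefix w zero    = []
prefix w (suc N) = prefix w N Data.List.++ (w N ∷ [])

-- If f^k(1) converges to wσ, then f maps prefixes of wσ to prefixes of wσ; in particular
-- f(1131133) = uuvuuvv is one, where u = f(1) and v = f(3). Hence wσ contains the squares uu
-- and vv. But wσ has no square of period greater than 7: as σ(2n) = σ(n), a square of period
-- divisible by 4 restricts to its even positions as a square of half the period, and on odd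
-- numbers σ is 4-periodic with σ(n) ≠ σ(n + 2); this rules out periods ≡ 2 mod 4 and odd
-- periods ≥ 9. So |u|, |v| ≤ 7, f is fixed by these two lengths, and |f^k(1)| → ∞ forces
-- |u| ≥ 2; the remaining finitely many candidates fail on the prefix 1131133 by computation.
module Submission where

open import Data.Empty using (⊥; ⊥-elim)
open import Data.Fin using (zero; suc)
open import Data.List using ([]; _∷_; _++_; length; take; drop)
open import Data.List.Properties using (∷-injectiveˡ; ∷-injectiveʳ; concatMap-++; take++drop≡id; ≡-dec)
open import Data.Nat using (ℕ; zero; suc; _+_; _*_; _%_; _≤_; _<_; _≤?_; z≤n; s≤s)
open import Data.Nat.DivMod using (result; _divMod_; m*n%n≡0; m*n/n≡m; [m+kn]%n≡m%n)
open import Data.Nat.Induction using (<-wellFounded)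
open import Data.Nat.Properties
  using ( ≤-refl; ≤-trans; ≤-reflexive; n≤1+n; 1+n≰n; ≰⇒>; m≤m+n; m≤n+m; m≤m*n
        ; +-identityʳ; +-suc; +-assoc; +-comm; *-assoc; *-distribʳ-+
        ; +-monoʳ-≤; +-monoʳ-<; *-monoˡ-≤; allUpTo?; module ≤-Reasoning )
open import Data.Nat.Tactic.RingSolver using (solve-∀)
open import Data.Product using (Σ; _×_; _,_; proj₁; proj₂)
open import Function using (_∘_)
open import Induction.WellFounded using (Acc; acc)
open import Relation.Binary.Definitions using (DecidableEquality)
open import Relation.Binary.PropositionalEquality
  using (_≡_; _≢_; refl; sym; trans; cong; cong₂; subst; subst₂; module ≡-Reasoning)
open import Relation.Nullary using (¬_; Dec; yes; no; ¬?; _→-dec_)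
open import Relation.Nullary.Decidable using (from-yes)

open import Defs

oddPartAux-odd : ∀ fuel {n} → n % 2 ≡ 1 → oddPartAux fuel n ≡ n
oddPartAux-odd zero    _     = refl
oddPartAux-odd (suc _) n%2≡1 rewrite n%2≡1 = refl

oddPartAux-even : ∀ fuel m → oddPartAux (suc fuel) (m * 2) ≡ oddPartAux fuel m
oddPartAux-even fuel m with m * 2 % 2 | m*n%n≡0 m 2
... | _ | refl = cong (oddPartAux fuel) (m*n/n≡m m 2)

[1+k*2]%2≡1 : ∀ k → suc (k * 2) % 2 ≡ 1
[1+k*2]%2≡1 k = [m+kn]%n≡m%n 1 k 2

oddPartAux-fuel : ∀ {n} f g → 1 ≤ n → n ≤ f → n ≤ g → oddPartAux f n ≡ oddPartAux g n
oddPartAux-fuel {n} f g 1≤n n≤f n≤g with n divMod 2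
... | result q (suc zero) refl =
  trans (oddPartAux-odd f ([1+k*2]%2≡1 q)) (sym (oddPartAux-odd g ([1+k*2]%2≡1 q)))
oddPartAux-fuel (suc f) (suc g) _ (s≤s n≤f) (s≤s n≤g) | result (suc m) zero refl =
  trans (oddPartAux-even f (suc m))
        (trans (oddPartAux-fuel f g (s≤s z≤n) (halve n≤f) (halve n≤g))
               (sym (oddPartAux-even g (suc m))))
  where
  halve : ∀ {h} → suc (m * 2) ≤ h → suc m ≤ h
  halve = ≤-trans (s≤s (m≤m*n m 2))

oddPart-double : ∀ m → oddPart (suc m * 2) ≡ oddPart (suc m)
oddPart-double m =
  trans (oddPartAux-even (suc (m * 2)) (suc m))
        (oddPartAux-fuel _ _ (s≤s z≤n) (s≤s (m≤m*n m 2)) ≤-refl)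

residueLetter : ℕ → Letter
residueLetter 1 = one
residueLetter _ = three

sigma≡residueLetter : ∀ n → sigma n ≡ residueLetter (oddPart n % 4)
sigma≡residueLetter n with oddPart n % 4
... | 0           = refl
... | 1           = refl
... | suc (suc _) = refl

sigma-double : ∀ {n} → 1 ≤ n → sigma (n * 2) ≡ sigma n
sigma-double {suc m} _ =
  trans (sigma≡residueLetter (suc m * 2))
        (trans (cong (λ k → residueLetter (k % 4)) (oddPart-double m))
               (sym (sigma≡residueLetter (suc m))))

[r+q*4]%2≡r%2 : ∀ r q → (r + q * 4) % 2 ≡ r % 2
[r+q*4]%2≡r%2 r q =
  trans (cong (λ k → (r + k) % 2) (sym (*-assoc q 2 2))) ([m+kn]%n≡m%n r (q * 2) 2)

sigma-odd : ∀ r q → r % 2 ≡ 1 → sigma (r + q * 4) ≡ residueLetter (r % 4)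
sigma-odd r q r%2≡1 = begin
  sigma (r + q * 4)
    ≡⟨ sigma≡residueLetter (r + q * 4) ⟩
  residueLetter (oddPart (r + q * 4) % 4)
    ≡⟨ cong (λ k → residueLetter (k % 4)) (oddPartAux-odd (r + q * 4) odd′) ⟩
  residueLetter ((r + q * 4) % 4)
    ≡⟨ cong residueLetter ([m+kn]%n≡m%n r q 4) ⟩
  residueLetter (r % 4)
    ∎
  where
  open ≡-Reasoning
  odd′ : (r + q * 4) % 2 ≡ 1
  odd′ = trans ([r+q*4]%2≡r%2 r q) r%2≡1

sigma-1mod4 : ∀ q → sigma (1 + q * 4) ≡ one
sigma-1mod4 q = sigma-odd 1 q refl

sigma-3mod4 : ∀ q → sigma (3 + q * 4) ≡ three
sigma-3mod4 q = sigma-odd 3 q refl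

data OddResidue : ℕ → Set where
  1mod4 : ∀ q → OddResidue (1 + q * 4)
  3mod4 : ∀ q → OddResidue (3 + q * 4)

oddResidue : ∀ n → n % 2 ≡ 1 → OddResidue n
oddResidue n n%2≡1 with n divMod 4
... | result q zero                   refl with () ← trans (sym ([r+q*4]%2≡r%2 0 q)) n%2≡1
... | result q (suc zero)             refl = 1mod4 q
... | result q (suc (suc zero))       refl with () ← trans (sym ([r+q*4]%2≡r%2 2 q)) n%2≡1
... | result q (suc (suc (suc zero))) refl = 3mod4 q

one≢three : one ≢ three
one≢three ()

2+e*4+[r+q*4]≡2+r+[e+q]*4 : ∀ e r q → 2 + e * 4 + (r + q * 4) ≡ 2 + r + (e + q) * 4
2+e*4+[r+q*4]≡2+r+[e+q]*4 = solve-∀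

sigma-odd-≢-2mod4+ : ∀ e n → n % 2 ≡ 1 → sigma n ≢ sigma (2 + e * 4 + n)
sigma-odd-≢-2mod4+ e n n%2≡1 eq with oddResidue n n%2≡1
... | 1mod4 q = one≢three (begin
  one                            ≡⟨ sigma-1mod4 q ⟨
  sigma (1 + q * 4)              ≡⟨ eq ⟩
  sigma (2 + e * 4 + (1 + q * 4)) ≡⟨ cong sigma (2+e*4+[r+q*4]≡2+r+[e+q]*4 e 1 q) ⟩
  sigma (3 + (e + q) * 4)        ≡⟨ sigma-3mod4 (e + q) ⟩
  three                          ∎)
  where open ≡-Reasoning
... | 3mod4 q = one≢three (begin
  one                            ≡⟨ sigma-1mod4 (suc (e + q)) ⟨
  sigma (1 + suc (e + q) * 4)    ≡⟨ cong sigma (2+e*4+[r+q*4]≡2+r+[e+q]*4 e 3 q) ⟨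
  sigma (2 + e * 4 + (3 + q * 4)) ≡⟨ eq ⟨
  sigma (3 + q * 4)              ≡⟨ sigma-3mod4 q ⟩
  three                          ∎)
  where open ≡-Reasoning

sigma-odd-≡-4+ : ∀ n → n % 2 ≡ 1 → sigma n ≡ sigma (4 + n)
sigma-odd-≡-4+ n n%2≡1 with oddResidue n n%2≡1
... | 1mod4 q = trans (sigma-1mod4 q) (sym (sigma-1mod4 (suc q)))
... | 3mod4 q = trans (sigma-3mod4 q) (sym (sigma-3mod4 (suc q)))

Square : (ℕ → Letter) → ℕ → ℕ → Set
Square w s d = ∀ i → i < d → w (i + s) ≡ w (i + s + d)

offset-to-odd : ∀ s → Σ ℕ λ i → i ≤ 1 × Σ ℕ λ q → i + s ≡ 1 + q * 2
offset-to-odd s with s divMod 2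
... | result q zero       refl = 1 , ≤-refl , q , refl
... | result q (suc zero) refl = 0 , z≤n , q , refl

¬square-2mod4 : ∀ s e → ¬ Square sigma s (2 + e * 4)
¬square-2mod4 s e sq with offset-to-odd s
... | i , i≤1 , q , i+s≡ = sigma-odd-≢-2mod4+ e (1 + q * 2) ([1+k*2]%2≡1 q) (begin
  sigma (1 + q * 2)                ≡⟨ cong sigma i+s≡ ⟨
  sigma (i + s)                    ≡⟨ sq i (≤-trans (s≤s i≤1) (m≤m+n 2 (e * 4))) ⟩
  sigma (i + s + (2 + e * 4))      ≡⟨ cong (λ k → sigma (k + (2 + e * 4))) i+s≡ ⟩
  sigma (1 + q * 2 + (2 + e * 4))  ≡⟨ cong sigma (+-comm (1 + q * 2) (2 + e * 4)) ⟩
  sigma (2 + e * 4 + (1 + q * 2))  ∎)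
  where open ≡-Reasoning

square-halve-at : ∀ {s d} δ u → δ ≤ 1 → δ + s ≡ suc u * 2 →
                  Square sigma s (d * 2) → Square sigma (suc u) d
square-halve-at {s} {d} δ u δ≤1 δ+s≡ sq j j<d = begin
  sigma (j + suc u)             ≡⟨ sigma-double 1≤j+1+u ⟨
  sigma ((j + suc u) * 2)       ≡⟨ cong sigma even ⟩
  sigma (i + s)                 ≡⟨ sq i i<2d ⟩
  sigma (i + s + d * 2)         ≡⟨ cong sigma even′ ⟩
  sigma ((j + suc u + d) * 2)   ≡⟨ sigma-double (≤-trans 1≤j+1+u (m≤m+n _ d)) ⟩
  sigma (j + suc u + d)         ∎
  where
  open ≡-Reasoning
  i = j * 2 + δ
  1≤j+1+u : 1 ≤ j + suc u
  1≤j+1+u = ≤-trans (s≤s z≤n) (m≤n+m (suc u) j)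
  even : (j + suc u) * 2 ≡ i + s
  even = begin
    (j + suc u) * 2      ≡⟨ *-distribʳ-+ 2 j (suc u) ⟩
    j * 2 + suc u * 2    ≡⟨ cong (j * 2 +_) δ+s≡ ⟨
    j * 2 + (δ + s)      ≡⟨ +-assoc (j * 2) δ s ⟨
    i + s                ∎
  even′ : i + s + d * 2 ≡ (j + suc u + d) * 2
  even′ = trans (cong (_+ d * 2) (sym even)) (sym (*-distribʳ-+ 2 (j + suc u) d))
  i<2d : i < d * 2
  i<2d = ≤-trans (+-monoʳ-< (j * 2) (s≤s δ≤1))
                 (≤-trans (≤-reflexive (+-comm (j * 2) 2)) (*-monoˡ-≤ 2 j<d))

square-halve : ∀ {s d} → 1 ≤ s → Square sigma s (d * 2) → Σ ℕ λ s′ → 1 ≤ s′ × Square sigma s′ d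
square-halve {s} 1≤s sq with s divMod 2
... | result (suc u) zero refl = suc u , s≤s z≤n , square-halve-at 0 u z≤n refl sq
... | result u (suc zero) refl = suc u , s≤s z≤n , square-halve-at 1 u ≤-refl refl sq

¬square-even-acc : ∀ {s} c → Acc _<_ c → 1 ≤ s → ¬ Square sigma s (suc c * 2)
¬square-even-acc {s} c (acc smaller) 1≤s sq with c divMod 2
... | result q zero refl = ¬square-2mod4 s q (subst (Square sigma s) (cong (2 +_) (*-assoc q 2 2)) sq)
... | result q (suc zero) refl with square-halve 1≤s sq
...   | s′ , 1≤s′ , sq′ = ¬square-even-acc q (smaller (s≤s (m≤m*n q 2))) 1≤s′ sq′

¬square-even : ∀ {s} c → 1 ≤ s → ¬ Square sigma s (suc c * 2)
¬square-even c = ¬square-even-acc c (<-wellFounded c)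

offset-to-2mod4 : ∀ s → Σ ℕ λ t → t ≤ 3 × Σ ℕ λ q → t + s ≡ suc (q * 2) * 2
offset-to-2mod4 s with s divMod 4
... | result q zero                   refl = 2 , s≤s (s≤s z≤n) , q     , cong (2 +_) (sym (*-assoc q 2 2))
... | result q (suc zero)             refl = 1 , s≤s z≤n       , q     , cong (2 +_) (sym (*-assoc q 2 2))
... | result q (suc (suc zero))       refl = 0 , z≤n           , q     , cong (2 +_) (sym (*-assoc q 2 2))
... | result q (suc (suc (suc zero))) refl = 3 , ≤-refl        , suc q , cong (6 +_) (sym (*-assoc q 2 2))

-- Positions t + s and 4 + t + s are 2(2q+1) and 2(2q+3), which carry the distinct letters
-- σ(2q+1) and σ(2q+3); but d = 2y+1 places later they are odd and 4 apart, so carry equal letters.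
¬square-odd-at : ∀ {s t} y q → Square sigma s (suc (y * 2)) →
                 4 + t < suc (y * 2) → t + s ≡ suc (q * 2) * 2 → ⊥
¬square-odd-at {s} {t} y q sq 4+t<d t+s≡ = sigma-odd-≢-2mod4+ 0 (suc (q * 2)) ([1+k*2]%2≡1 q) (begin
  sigma (suc (q * 2))                    ≡⟨ sigma-double {suc (q * 2)} (s≤s z≤n) ⟨
  sigma (suc (q * 2) * 2)                ≡⟨ cong sigma t+s≡ ⟨
  sigma (t + s)                          ≡⟨ sq t (≤-trans (s≤s (m≤n+m t 4)) 4+t<d) ⟩
  sigma (t + s + d)                      ≡⟨ sigma-odd-≡-4+ (t + s + d) odd-position ⟩
  sigma (4 + t + s + d)                  ≡⟨ sq (4 + t) 4+t<d ⟨
  sigma (4 + t + s)                      ≡⟨ cong (λ k → sigma (4 + k)) t+s≡ ⟩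
  sigma (suc (suc (suc (q * 2))) * 2)    ≡⟨ sigma-double {suc (suc (suc (q * 2)))} (s≤s z≤n) ⟩
  sigma (2 + suc (q * 2))                ∎)
  where
  open ≡-Reasoning
  d = suc (y * 2)
  m = suc (q * 2) + y
  t+s+d≡ : t + s + d ≡ suc (m * 2)
  t+s+d≡ = begin
    t + s + d                    ≡⟨ cong (_+ d) t+s≡ ⟩
    suc (q * 2) * 2 + d          ≡⟨ +-suc (suc (q * 2) * 2) (y * 2) ⟩
    suc (suc (q * 2) * 2 + y * 2) ≡⟨ cong suc (*-distribʳ-+ 2 (suc (q * 2)) y) ⟨
    suc (m * 2)                  ∎
  odd-position : (t + s + d) % 2 ≡ 1
  odd-position = trans (cong (_% 2) t+s+d≡) ([1+k*2]%2≡1 m)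

¬square-odd : ∀ s y → 4 ≤ y → ¬ Square sigma s (suc (y * 2))
¬square-odd s y 4≤y sq with offset-to-2mod4 s
... | t , t≤3 , q , t+s≡ = ¬square-odd-at y q sq 4+t<d t+s≡
  where
  4+t<d : 4 + t < suc (y * 2)
  4+t<d = s≤s (begin
    4 + t   ≤⟨ +-monoʳ-≤ 4 t≤3 ⟩
    7       ≤⟨ n≤1+n 7 ⟩
    4 * 2   ≤⟨ *-monoˡ-≤ 2 4≤y ⟩
    y * 2   ∎)
    where open ≤-Reasoning

square-period≤7 : ∀ {s d} → 1 ≤ s → Square sigma s d → d ≤ 7
square-period≤7 {s} {d} 1≤s sq with d divMod 2
... | result zero zero refl = z≤n
... | result (suc c) zero refl = ⊥-elim (¬square-even c 1≤s sq)
... | result y (suc zero) refl with y ≤? 3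
...   | yes y≤3 = s≤s (*-monoˡ-≤ 2 y≤3)
...   | no  y≰3 = ⊥-elim (¬square-odd s y (≰⇒> y≰3) sq)

window : (ℕ → Letter) → ℕ → ℕ → Word
window w s zero    = []
window w s (suc n) = w s ∷ window w (suc s) n

length-window : ∀ w s n → length (window w s n) ≡ n
length-window w s zero    = refl
length-window w s (suc n) = cong suc (length-window w (suc s) n)

window-suc : ∀ w s n → window w s (suc n) ≡ window w s n ++ w (s + n) ∷ []
window-suc w s zero    = cong (λ k → w k ∷ []) (sym (+-identityʳ s))
window-suc w s (suc n) = cong (w s ∷_) (begin
  window w (suc s) (suc n)                ≡⟨ window-suc w (suc s) n ⟩
  window w (suc s) n ++ w (suc s + n) ∷ [] ≡⟨ cong (λ k → window w (suc s) n ++ w k ∷ []) (+-suc s n) ⟨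
  window w (suc s) n ++ w (s + suc n) ∷ [] ∎)
  where open ≡-Reasoning

prefix≡window : ∀ w n → prefix w n ≡ window w 0 n
prefix≡window w zero    = refl
prefix≡window w (suc n) = trans (cong (_++ w n ∷ []) (prefix≡window w n)) (sym (window-suc w 0 n))

++≡window⁻ : ∀ {w} xs {ys s n} → xs ++ ys ≡ window w s n →
             xs ≡ window w s (length xs) × ys ≡ window w (s + length xs) (length ys)
++≡window⁻ {w} [] {s = s} {n} refl = refl , cong₂ (window w) (sym (+-identityʳ s)) (sym (length-window w s n))
++≡window⁻ {w} (x ∷ xs) {ys} {s} {suc n} eq with ++≡window⁻ xs (∷-injectiveʳ eq)
... | xs≡ , ys≡ =
  cong₂ _∷_ (∷-injectiveˡ eq) xs≡ , trans ys≡ (cong (λ k → window w k (length ys)) (sym (+-suc s (length xs))))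

window-≡⇒pointwise : ∀ {w s t} n → window w s n ≡ window w t n → ∀ i → i < n → w (i + s) ≡ w (i + t)
window-≡⇒pointwise (suc n) eq zero    _         = ∷-injectiveˡ eq
window-≡⇒pointwise {w} {s} {t} (suc n) eq (suc i) (s≤s i<n) =
  subst₂ (λ k l → w k ≡ w l) (+-suc i s) (+-suc i t) (window-≡⇒pointwise n (∷-injectiveʳ eq) i i<n)

xxy≡window⁻ : ∀ {w} xs {ys s n} → xs ++ xs ++ ys ≡ window w s n →
              xs ≡ window w s (length xs) × Square w s (length xs)
xxy≡window⁻ {w} xs {s = s} eq with ++≡window⁻ xs eq
... | xs≡ , rest with ++≡window⁻ xs rest
...   | xs≡′ , _ = xs≡ , λ i i<d →
  trans (window-≡⇒pointwise (length xs) (trans (sym xs≡) xs≡′) i i<d)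
        (cong w (sym (+-assoc i s (length xs))))

square-suc : ∀ {w s d} → Square (λ i → w (suc i)) s d → Square w (suc s) d
square-suc {s = s} sq i i<d rewrite +-suc i s = sq i i<d

wσ-square-period<8 : ∀ {p d} → Square wσ p d → d < 8
wσ-square-period<8 sq = s≤s (square-period≤7 (s≤s z≤n) (square-suc {sigma} sq))

PrefixesConverge : Morphism → (ℕ → Letter) → Set
PrefixesConverge f w = (N : ℕ) → Σ ℕ λ K → (k : ℕ) → K ≤ k → take N (iter f k (one ∷ [])) ≡ prefix w N

LengthsDiverge : Morphism → Set
LengthsDiverge f = (M : ℕ) → Σ ℕ λ K → (k : ℕ) → K ≤ k → M ≤ length (iter f k (one ∷ []))

take-length-++ : ∀ (xs ys : Word) → take (length xs) (xs ++ ys) ≡ xs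
take-length-++ []       ys = refl
take-length-++ (x ∷ xs) ys = cong (x ∷_) (take-length-++ xs ys)

ImageOfPrefixIsPrefix : Morphism → (ℕ → Letter) → ℕ → Set
ImageOfPrefixIsPrefix f w n = apply f (prefix w n) ≡ prefix w (length (apply f (prefix w n)))

image-of-prefix-is-prefix : ∀ {f w} → PrefixesConverge f w → ∀ n → ImageOfPrefixIsPrefix f w n
image-of-prefix-is-prefix {f} {w} converge n = begin
  P                                      ≡⟨ take-length-++ P R ⟨
  take N (P ++ R)                        ≡⟨ cong (λ z → take N (apply f z ++ R)) W-prefix ⟨
  take N (apply f (take n W) ++ R)       ≡⟨ cong (take N) (concatMap-++ (image f) (take n W) (drop n W)) ⟨
  take N (apply f (take n W ++ drop n W)) ≡⟨ cong (λ z → take N (apply f z)) (take++drop≡id n W) ⟩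
  take N (apply f W)                     ≡⟨ fW-prefix ⟩
  prefix w N                             ∎
  where
  open ≡-Reasoning
  P = apply f (prefix w n)
  N = length P
  Kₙ = proj₁ (converge n)
  K_N = proj₁ (converge N)
  W = iter f (Kₙ + K_N) (one ∷ [])
  R = apply f (drop n W)
  W-prefix : take n W ≡ prefix w n
  W-prefix = proj₂ (converge n) (Kₙ + K_N) (m≤m+n Kₙ K_N)
  fW-prefix : take N (apply f W) ≡ prefix w N
  fW-prefix = proj₂ (converge N) (suc (Kₙ + K_N)) (≤-trans (m≤n+m K_N Kₙ) (n≤1+n _))

image-of-1131133 : ∀ u v → ImageOfPrefixIsPrefix (morph u v) wσ 7 →
  u ≡ window wσ 0 (length u) × v ≡ window wσ (length u + length u) (length v)
  × Square wσ 0 (length u) × Σ ℕ λ p → Square wσ p (length v)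
image-of-1131133 u v eq =
  proj₁ (xxy≡window⁻ u uuvuuvv) , proj₁ (++≡window⁻ v vuuvv) ,
  proj₂ (xxy≡window⁻ u uuvuuvv) , _ , proj₂ (xxy≡window⁻ v (after u (after u (after v vuuvv))))
  where
  after : ∀ xs {ys t m} → xs ++ ys ≡ window wσ t m → ys ≡ window wσ (t + length xs) (length ys)
  after xs = proj₂ ∘ ++≡window⁻ xs
  uuvuuvv = trans eq (prefix≡window wσ (length (apply (morph u v) (prefix wσ 7))))
  vuuvv = after u (after u uuvuuvv)

iter-suc : ∀ f k xs → iter f (suc k) xs ≡ iter f k (apply f xs)
iter-suc f zero    xs = refl
iter-suc f (suc k) xs = cong (apply f) (iter-suc f k xs)

iter-fixed : ∀ f {xs} → apply f xs ≡ xs → ∀ k → iter f k xs ≡ xs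
iter-fixed f fxs≡xs zero    = refl
iter-fixed f fxs≡xs (suc k) = trans (cong (apply f) (iter-fixed f fxs≡xs k)) fxs≡xs

fixed-image⇒¬LengthsDiverge : ∀ f {xs} → apply f (one ∷ []) ≡ xs → apply f xs ≡ xs → ¬ LengthsDiverge f
fixed-image⇒¬LengthsDiverge f {xs} f1≡xs fxs≡xs diverge =
  1+n≰n (subst (λ ys → suc (length xs) ≤ length ys) iterate≡xs (long (suc K) (n≤1+n K)))
  where
  K = proj₁ (diverge (suc (length xs)))
  long = proj₂ (diverge (suc (length xs)))
  iterate≡xs : iter f (suc K) (one ∷ []) ≡ xs
  iterate≡xs = trans (iter-suc f K _) (trans (cong (iter f K) f1≡xs) (iter-fixed f fxs≡xs K))

2≤length-img1 : ∀ {u v} → LengthsDiverge (morph u v) → u ≡ window wσ 0 (length u) → 2 ≤ length u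
2≤length-img1 {[]}          diverge _    = ⊥-elim (fixed-image⇒¬LengthsDiverge _ refl refl diverge)
2≤length-img1 {_ ∷ []}      diverge refl = ⊥-elim (fixed-image⇒¬LengthsDiverge _ refl refl diverge)
2≤length-img1 {_ ∷ _ ∷ _}  _       _    = s≤s (s≤s z≤n)

_≟_ : DecidableEquality Letter
one   ≟ one   = yes refl
one   ≟ three = no λ ()
three ≟ one   = no λ ()
three ≟ three = yes refl

imageOfPrefixIsPrefix? : ∀ f w n → Dec (ImageOfPrefixIsPrefix f w n)
imageOfPrefixIsPrefix? f w n = ≡-dec _≟_ _ _

-- Once f(1)f(1)f(3) is a prefix of wσ, f is determined by |f(1)| and |f(3)|.
candidate : ℕ → ℕ → Morphism
candidate a b = morph (window wσ 0 a) (window wσ (a + a) b)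

no-short-candidate : ∀ {a} → a < 8 → ∀ {b} → b < 8 → 2 ≤ a → ¬ ImageOfPrefixIsPrefix (candidate a b) wσ 7
no-short-candidate = from-yes
  (allUpTo? (λ a → allUpTo? (λ b → 2 ≤? a →-dec ¬? (imageOfPrefixIsPrefix? (candidate a b) wσ 7)) 8) 8)

theorem10 : ¬ (Σ Morphism λ f →
                 ((M : ℕ) → Σ ℕ λ K → (k : ℕ) → K ≤ k → M ≤ length (iter f k (one ∷ [])))
                 × ((N : ℕ) → Σ ℕ λ K → (k : ℕ) → K ≤ k → take N (iter f k (one ∷ [])) ≡ prefix wσ N))
theorem10 (morph u v , diverge , converge) =
  let image-prefix = image-of-prefix-is-prefix converge 7
      (u≡ , v≡ , u-square , _ , v-square) = image-of-1131133 u v image-prefix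
  in no-short-candidate (wσ-square-period<8 u-square) (wσ-square-period<8 v-square)
                        (2≤length-img1 diverge u≡)
                        (subst₂ (λ x y → ImageOfPrefixIsPrefix (morph x y) wσ 7) u≡ v≡ image-prefix)
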